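{- Let $\Bbbk$ be a commutative ring with unit $1\neq0$ and without zero divisors, let $a\in\mathbb{N}$ and $\alpha\in\Bbbk$. If $n\in\mathbb{N}$ and $n\ge a$, then $(L-\alpha)^a\bigl(s(\alpha,n)\bigr)=s(\alpha,n-a)$.
   Context: $\mathfrak{S}_\Bbbk$ is the $\Bbbk$-module of all sequences $s=(s_0,s_1,\dots)$ of elements of $\Bbbk$ with termwise operations; $L$ is the left shift $(Ls)_i=s_{i+1}$ and $\alpha$ denotes multiplication by $\alpha$. For $s\in\mathfrak{S}_\Bbbk$ and $p(x)=\sum_ic_ix^i\in\Bbbk[x]$, $\langle s,p\rangle=\sum_ic_is_i$. The divided derivatives $\delta^m:\Bbbk[x]\to\Bbbk[x]$ are defined by $p(x+y)=\sum_{m\ge0}(\delta^mp)(x)y^m$ in $\Bbbk[x,y]$, and $D^m:\mathfrak{S}_\Bbbk\to\mathfrak{S}_\Bbbk$ is the unique map with $\langle D^m(s),p\rangle=\langle s,\delta^m(p)\rangle$ for all $s,p$. $s(\alpha)_i=\alpha^i$ (with $\alpha^0=1$) and $s(\alpha,m)=D^m(s(\alpha))$. -}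

module Defs where

open import Level using (_⊔_)
open import Data.Nat using (ℕ; zero; suc)
open import Data.Nat.Combinatorics using (_C_)
open import Data.List using (List; []; _∷_; replicate; _++_; drop)
open import Algebra.Bundles using (CommutativeRing)

module Seqs {c ℓ} (R : CommutativeRing c ℓ) where
  open CommutativeRing R

  Seq : Set c
  Seq = ℕ → Carrier

  -- polynomials in 𝕜[x] as coefficient lists [c₀ , c₁ , …]
  Poly : Set c
  Poly = List Carrier

  ⟪_,_⟫ : Seq → Poly → Carrier
  ⟪ s , [] ⟫ = 0#
  ⟪ s , c ∷ p ⟫ = c * s 0 + ⟪ (λ i → s (suc i)) , p ⟫

  nat : ℕ → Carrier
  nat zero = 0#
  nat (suc n) = 1# + nat n

  pow : Carrier → ℕ → Carrier
  pow α zero = 1#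
  pow α (suc i) = α * pow α i

  xpow : ℕ → Poly
  xpow i = replicate i 0# ++ (1# ∷ [])

  binomScale : ℕ → ℕ → Poly → Poly
  binomScale m k [] = []
  binomScale m k (c ∷ p) = (nat (k C m) * c) ∷ binomScale m (suc k) p

  -- divided derivative δ^m: p(x+y) = Σ_m (δ^m p)(x) y^m, i.e.
  -- δ^m (Σ cᵢ xⁱ) = Σ_{i ≥ m} binom(i,m) cᵢ x^{i-m}
  δ : ℕ → Poly → Poly
  δ m p = drop m (binomScale m 0 p)

  -- D^m : the unique map with ⟨D^m s, p⟩ = ⟨s, δ^m p⟩; its i-th term is ⟨D^m s, xⁱ⟩
  D : ℕ → Seq → Seq
  D m s i = ⟪ s , δ m (xpow i) ⟫

  L : Seq → Seq
  L s i = s (suc i)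

  L-α : Carrier → Seq → Seq
  L-α α s i = L s i - α * s i

  iter : ℕ → (Seq → Seq) → Seq → Seq
  iter zero f s = s
  iter (suc a) f s = f (iter a f s)

  sα : Carrier → Seq
  sα α i = pow α i

  sαm : Carrier → ℕ → Seq
  sαm α m = D m (sα α)

module Submission where

-- Pairing a sequence with δ^m(xⁱ) = binom(i,m) x^(i-m) gives D^m(s)ᵢ = binom(i,m) s_(i-m),
-- the term being 0 when i < m.  Hence s(α,m)ᵢ = binom(i,m) α^(i-m), and Pascal's rule
-- binom(i+1,m+1) = binom(i,m) + binom(i,m+1) yields (L - α) s(α,m+1) = s(α,m); iterating a
-- times gives the theorem.  No hypothesis on the ring beyond commutativity is needed.

open import Defs
open import Level using (Level)
open import Data.Nat using (ℕ; _≤_; _∸_)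
open import Data.Sum using (_⊎_)
open import Relation.Nullary using (¬_)
open import Algebra.Bundles using (CommutativeRing)

open import Data.Nat using (zero; suc; _+_; _<_; _<?_; s≤s)
open import Data.Nat.Properties as ℕ using (m+[n∸m]≡n; +-suc; ≰⇒>)
open import Data.Nat.Combinatorics using (_C_; nCk+nC[k+1]≡[n+1]C[k+1]; k>n⇒nCk≡0)
open import Data.List using (_∷_; []; drop)
import Relation.Binary.PropositionalEquality as ≡
open import Relation.Nullary using (yes; no)

module _ {c ℓ} (R : CommutativeRing c ℓ) where
  open CommutativeRing R renaming (_+_ to _⊕_)
  open Seqs R
  open import Relation.Binary.Reasoning.Setoid setoid
  open import Algebra.Properties.CommutativeSemigroup *-commutativeSemigroup using (x∙yz≈y∙xz)

  _≗_ : Seq → Seq → Set ℓ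
  s ≗ t = ∀ i → s i ≈ t i

  ⟪⟫-congˡ : ∀ {s t} → s ≗ t → ∀ p → ⟪ s , p ⟫ ≈ ⟪ t , p ⟫
  ⟪⟫-congˡ s≗t []      = refl
  ⟪⟫-congˡ s≗t (x ∷ p) = +-cong (*-congˡ (s≗t 0)) (⟪⟫-congˡ (λ i → s≗t (suc i)) p)

  nat-+ : ∀ m n → nat (m + n) ≈ nat m ⊕ nat n
  nat-+ zero    n = sym (+-identityˡ _)
  nat-+ (suc m) n = trans (+-congˡ (nat-+ m n)) (sym (+-assoc _ _ _))

  shiftʳ : ℕ → Seq → Seq
  shiftʳ zero    s         = s
  shiftʳ (suc m) s zero    = 0#
  shiftʳ (suc m) s (suc i) = shiftʳ m s i

  ⟪⟫-drop : ∀ m s p → ⟪ s , drop m p ⟫ ≈ ⟪ shiftʳ m s , p ⟫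
  ⟪⟫-drop zero    s p       = refl
  ⟪⟫-drop (suc m) s []      = refl
  ⟪⟫-drop (suc m) s (x ∷ p) = begin
    ⟪ s , drop m p ⟫                 ≈⟨ ⟪⟫-drop m s p ⟩
    ⟪ shiftʳ m s , p ⟫               ≈⟨ +-identityˡ _ ⟨
    0# ⊕ ⟪ shiftʳ m s , p ⟫          ≈⟨ +-congʳ (zeroʳ x) ⟨
    x * 0# ⊕ ⟪ shiftʳ m s , p ⟫      ∎

  ⟪⟫-binomScale : ∀ m k s p →
    ⟪ s , binomScale m k p ⟫ ≈ ⟪ (λ i → nat ((k + i) C m) * s i) , p ⟫
  ⟪⟫-binomScale m k s []      = refl
  ⟪⟫-binomScale m k s (x ∷ p) = +-cong head tail
    where
    head : nat (k C m) * x * s 0 ≈ x * (nat ((k + 0) C m) * s 0)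
    head rewrite ℕ.+-identityʳ k = begin
      nat (k C m) * x * s 0      ≈⟨ *-congʳ (*-comm _ _) ⟩
      x * nat (k C m) * s 0      ≈⟨ *-assoc _ _ _ ⟩
      x * (nat (k C m) * s 0)    ∎
    tail : ⟪ L s , binomScale m (suc k) p ⟫
         ≈ ⟪ (λ i → nat ((k + suc i) C m) * s (suc i)) , p ⟫
    tail = trans (⟪⟫-binomScale m (suc k) (L s) p)
                 (⟪⟫-congˡ (λ i → reflexive (≡.cong (λ j → nat (j C m) * s (suc i))
                                                     (≡.sym (+-suc k i)))) p)

  ⟪⟫-xpow : ∀ s i → ⟪ s , xpow i ⟫ ≈ s i
  ⟪⟫-xpow s zero    = trans (+-identityʳ _) (*-identityˡ _)
  ⟪⟫-xpow s (suc i) = trans (+-cong (zeroˡ _) (⟪⟫-xpow (L s) i)) (+-identityˡ _)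

  D-closedForm : ∀ m s i → D m s i ≈ nat (i C m) * shiftʳ m s i
  D-closedForm m s i = begin
    ⟪ s , drop m (binomScale m 0 (xpow i)) ⟫             ≈⟨ ⟪⟫-drop m s _ ⟩
    ⟪ shiftʳ m s , binomScale m 0 (xpow i) ⟫             ≈⟨ ⟪⟫-binomScale m 0 (shiftʳ m s) (xpow i) ⟩
    ⟪ (λ j → nat (j C m) * shiftʳ m s j) , xpow i ⟫      ≈⟨ ⟪⟫-xpow _ i ⟩
    nat (i C m) * shiftʳ m s i                           ∎

  L-α-cong : ∀ α {s t} → s ≗ t → L-α α s ≗ L-α α t
  L-α-cong α s≗t i = +-cong (s≗t (suc i)) (-‿cong (*-congˡ (s≗t i)))

  module _ (α : Carrier) where

    binomialPower : ℕ → Seq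
    binomialPower m i = nat (i C m) * shiftʳ m (sα α) i

    shiftʳ-sα-suc : ∀ m i → m < i → shiftʳ m (sα α) i ≈ α * shiftʳ (suc m) (sα α) i
    shiftʳ-sα-suc zero    (suc i) _          = refl
    shiftʳ-sα-suc (suc m) (suc i) (s≤s m<i) = shiftʳ-sα-suc m i m<i

    -- For i ≤ m the binomial coefficient vanishes, which covers the boundary term.
    binomialPower-shift : ∀ m i →
      nat (i C suc m) * shiftʳ m (sα α) i ≈ α * binomialPower (suc m) i
    binomialPower-shift m i with m <? i
    ... | yes m<i = begin
      nat (i C suc m) * shiftʳ m (sα α) i                  ≈⟨ *-congˡ (shiftʳ-sα-suc m i m<i) ⟩
      nat (i C suc m) * (α * shiftʳ (suc m) (sα α) i)      ≈⟨ x∙yz≈y∙xz _ _ _ ⟩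
      α * (nat (i C suc m) * shiftʳ (suc m) (sα α) i)      ∎
    ... | no m≮i rewrite k>n⇒nCk≡0 {i} {suc m} (≰⇒> m≮i) = begin
      0# * shiftʳ m (sα α) i                               ≈⟨ zeroˡ _ ⟩
      0#                                                   ≈⟨ zeroʳ α ⟨
      α * 0#                                               ≈⟨ *-congˡ (zeroˡ _) ⟨
      α * (0# * shiftʳ (suc m) (sα α) i)                   ∎

    binomialPower-pascal : ∀ m i →
      binomialPower (suc m) (suc i) ≈ binomialPower m i ⊕ α * binomialPower (suc m) i
    binomialPower-pascal m i = begin
      nat (suc i C suc m) * shiftʳ m (sα α) i
        ≈⟨ *-congʳ (reflexive (≡.cong nat (≡.sym (nCk+nC[k+1]≡[n+1]C[k+1] i m)))) ⟩
      nat (i C m + i C suc m) * shiftʳ m (sα α) i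
        ≈⟨ *-congʳ (nat-+ (i C m) (i C suc m)) ⟩
      (nat (i C m) ⊕ nat (i C suc m)) * shiftʳ m (sα α) i
        ≈⟨ distribʳ _ _ _ ⟩
      binomialPower m i ⊕ nat (i C suc m) * shiftʳ m (sα α) i
        ≈⟨ +-congˡ (binomialPower-shift m i) ⟩
      binomialPower m i ⊕ α * binomialPower (suc m) i
        ∎

    L-α-sαm-suc : ∀ m → L-α α (sαm α (suc m)) ≗ sαm α m
    L-α-sαm-suc m i = begin
      sαm α (suc m) (suc i) - α * sαm α (suc m) i
        ≈⟨ +-cong (D-closedForm (suc m) (sα α) (suc i))
                  (-‿cong (*-congˡ (D-closedForm (suc m) (sα α) i))) ⟩
      binomialPower (suc m) (suc i) - α * binomialPower (suc m) i
        ≈⟨ +-congʳ (binomialPower-pascal m i) ⟩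
      (binomialPower m i ⊕ α * binomialPower (suc m) i) - α * binomialPower (suc m) i
        ≈⟨ +-assoc _ _ _ ⟩
      binomialPower m i ⊕ (α * binomialPower (suc m) i - α * binomialPower (suc m) i)
        ≈⟨ +-congˡ (-‿inverseʳ _) ⟩
      binomialPower m i ⊕ 0#
        ≈⟨ +-identityʳ _ ⟩
      binomialPower m i
        ≈⟨ D-closedForm m (sα α) i ⟨
      sαm α m i
        ∎

    iter-L-α-sαm : ∀ a n → iter a (L-α α) (sαm α (a + n)) ≗ sαm α n
    iter-L-α-sαm zero    n = λ i → refl
    iter-L-α-sαm (suc a) n rewrite ≡.sym (+-suc a n) = λ i →
      trans (L-α-cong α (iter-L-α-sαm a (suc n)) i) (L-α-sαm-suc n i)

lemma3p5 : ∀ {c ℓ : Level} (R : CommutativeRing c ℓ) →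
    let open CommutativeRing R
        open Seqs R
    in ¬ (1# ≈ 0#) →
       (∀ x y → x * y ≈ 0# → (x ≈ 0#) ⊎ (y ≈ 0#)) →
       (a : ℕ) (α : Carrier) (n : ℕ) → a ≤ n →
       ∀ i → iter a (L-α α) (sαm α n) i ≈ sαm α (n ∸ a) i
lemma3p5 R _ _ a α n a≤n i =
  ≡.subst (λ k → iter a (L-α α) (sαm α k) i ≈ sαm α (n ∸ a) i)
          (m+[n∸m]≡n a≤n)
          (iter-L-α-sαm R α a (n ∸ a) i)
  where open CommutativeRing R
        open Seqs R
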